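{- Let $\mathrm{DASH}$ (described in the context) be run on any connected graph $G$ on $n$ nodes under any sequence of adversarial single-node deletions. Then at every time, the set $E'$ of edges added by the algorithm forms a forest, i.e. the graph $G'$ is acyclic.
   Context: Model: the network is initially a connected graph $G$ on $n$ nodes. In each round an adversary deletes one node $x$; then the healing algorithm may add edges only between former neighbors of $x$. $G$ denotes the current network, and $G'=(V,E')$ denotes the graph on the current nodes whose edges $E'$ are exactly the healing edges added so far (edges incident to deleted nodes disappear). $N(v,G)$, $N(v,G')$ are neighbor sets; $\delta(v)$ is the current degree of $v$ minus its initial degree. Algorithm $\mathrm{DASH}$: Initially every vertex is given an $ID$ chosen uniformly at random from $[0,1]$. When a vertex $v$ is deleted: partition the neighbors of $v$ in $G$ not having the same $ID$ as $v$ into classes according to their $ID$, and let $UN(v,G)$ contain one representative of each class (the one with lowest initial $ID$). Let $S=UN(v,G)\cup N(v,G')$. Connect the nodes of $S$ by new edges into a complete binary tree, filling positions top-down, left to right, in increasing order of $\delta$. Let $MINID$ be the minimum $ID$ in $S$; propagate it through the tree of $G'$ containing $S$, and all nodes of that tree set their $ID$ to $MINID$. -}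

module Defs where

open import Data.Bool using (Bool; true; false; _∧_; _∨_; not; if_then_else_)
open import Data.Nat using (ℕ; zero; suc; _≡ᵇ_; _<ᵇ_; _⊓_; _≤_; ⌊_/2⌋)
open import Data.Integer as ℤ using (ℤ; _⊖_)
open import Data.Fin using (Fin; toℕ)
import Data.Fin as Fin
open import Data.List using (List; []; _∷_; _++_; length; filterᵇ; allFin; foldr; map; [_])
open import Data.Bool.ListAction using (all; any)
open import Data.List.Relation.Unary.Linked using (Linked)
open import Data.List.Relation.Unary.Unique.Propositional using (Unique)
open import Data.List.Relation.Binary.Permutation.Propositional using (_↭_)
open import Data.Maybe using (Maybe; just; nothing)
open import Data.Product using (_×_; _,_; Σ; ∃)
open import Relation.Nullary using (¬_)
open import Relation.Nullary.Decidable using (isYes)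
open import Relation.Binary.PropositionalEquality using (_≡_)
open import Relation.Binary.Construct.Closure.ReflexiveTransitive using (Star)

Graph : ℕ → Set
Graph n = Fin n → Fin n → Bool

record SimpleGraph (n : ℕ) : Set where
  field
    adj     : Graph n
    adj-sym : ∀ u v → adj u v ≡ adj v u
    irrefl  : ∀ u → adj u u ≡ false
open SimpleGraph public

Connected : ∀ {n} → SimpleGraph n → Set
Connected G = ∀ u v → Star (λ a b → adj G a b ≡ true) u v

_==_ : ∀ {n} → Fin n → Fin n → Bool
u == v = isYes (u Fin.≟ v)

count : ∀ {A : Set} → (A → Bool) → List A → ℕ
count p xs = length (filterᵇ p xs)

-- State of the network during the run.
--   alive : current node set V
--   E     : edges of the current network G (only between alive nodes)
--   E'    : the healing edges added so far (graph G')
--   ID    : current IDs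

record State (n : ℕ) : Set where
  constructor mkState
  field
    alive : Fin n → Bool
    E     : Graph n
    E'    : Graph n
    ID    : Fin n → ℕ
open State public

initState : ∀ {n} → SimpleGraph n → (Fin n → ℕ) → State n
initState G id0 = mkState (λ _ → true) (adj G) (λ _ _ → false) id0

initDeg : ∀ {n} → SimpleGraph n → Fin n → ℕ
initDeg {n} G u = count (adj G u) (allFin n)

deg : ∀ {n} → State n → Fin n → ℕ
deg {n} s u = count (λ v → alive s v ∧ E s u v) (allFin n)

module DASH {n : ℕ} (G : SimpleGraph n) (id0 : Fin n → ℕ) where

  NG : State n → Fin n → List (Fin n)
  NG s x = filterᵇ (λ y → alive s y ∧ E s x y ∧ not (y == x)) (allFin n)

  NG' : State n → Fin n → List (Fin n)
  NG' s x = filterᵇ (λ y → alive s y ∧ E' s x y ∧ not (y == x)) (allFin n)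

  cand : State n → Fin n → List (Fin n)
  cand s x = filterᵇ (λ y → not (ID s y ≡ᵇ ID s x)) (NG s x)

  precedes : Fin n → Fin n → Bool
  precedes z y = (id0 z <ᵇ id0 y) ∨ ((id0 z ≡ᵇ id0 y) ∧ (toℕ z <ᵇ toℕ y))

  -- UN(x,G): one representative per ID class, the one of lowest initial ID
  UN : State n → Fin n → List (Fin n)
  UN s x = filterᵇ (λ y → all (λ z → not (ID s z ≡ᵇ ID s y) ∨ not (precedes z y)) (cand s x)) (cand s x)

  elem : Fin n → List (Fin n) → Bool
  elem y l = any (λ z → z == y) l

  S : State n → Fin n → List (Fin n)
  S s x = UN s x ++ filterᵇ (λ y → not (elem y (UN s x))) (NG' s x)

  delete : State n → Fin n → State n
  delete s x = mkState (λ y → alive s y ∧ not (y == x))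
                       (λ u v → E s u v ∧ not (u == x) ∧ not (v == x))
                       (λ u v → E' s u v ∧ not (u == x) ∧ not (v == x))
                       (ID s)

  δ : State n → Fin n → Fin n → ℤ
  δ s x y = deg (delete s x) y ⊖ initDeg G y

  -- complete binary tree on a list filled top-down, left to right:
  -- the element at position i ≥ 1 is joined to the element at position ⌊(i-1)/2⌋
  nth : List (Fin n) → ℕ → Maybe (Fin n)
  nth [] _ = nothing
  nth (a ∷ as) zero = just a
  nth (a ∷ as) (suc i) = nth as i

  pairsFrom : ℕ → List (Fin n) → List (Fin n) → List (Fin n × Fin n)
  pairsFrom i full [] = []
  pairsFrom zero full (a ∷ as) = pairsFrom 1 full as
  pairsFrom (suc j) full (a ∷ as) with nth full ⌊ j /2⌋
  ... | just p  = (a , p) ∷ pairsFrom (suc (suc j)) full as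
  ... | nothing = pairsFrom (suc (suc j)) full as

  treePairs : List (Fin n) → List (Fin n × Fin n)
  treePairs l = pairsFrom 0 l l

  treeEdge : List (Fin n) → Graph n
  treeEdge l u v = any (λ { (a , b) → ((a == u) ∧ (b == v)) ∨ ((a == v) ∧ (b == u)) }) (treePairs l)

  minID : List ℕ → ℕ
  minID [] = 0
  minID (a ∷ as) = foldr _⊓_ a as

  reachWithin : ℕ → Graph n → (Fin n → Bool) → Fin n → Bool
  reachWithin zero H R y = R y
  reachWithin (suc k) H R y =
    reachWithin k H R y ∨ any (λ z → reachWithin k H R z ∧ H z y) (allFin n)

  heal : State n → Fin n → List (Fin n) → State n
  heal s x ord = mkState (alive s₁) E₂ E'₂ ID₂
    where
      s₁ = delete s x
      E₂ : Graph n
      E₂ u v = E s₁ u v ∨ treeEdge ord u v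
      E'₂ : Graph n
      E'₂ u v = E' s₁ u v ∨ treeEdge ord u v
      MINID : ℕ
      MINID = minID (map (ID s) (S s x))
      inTree : Fin n → Bool
      inTree = reachWithin n E'₂ (λ y → elem y (S s x))
      ID₂ : Fin n → ℕ
      ID₂ y = if inTree y then MINID else ID s y

  -- All states reachable under any sequence of adversarial deletions.
  -- The order of S in the tree is any arrangement of S in nondecreasing δ
  -- (ties broken arbitrarily).
  data Reachable : State n → Set where
    start : Reachable (initState G id0)
    round : ∀ {s} → Reachable s → (x : Fin n) → alive s x ≡ true →
            (ord : List (Fin n)) → ord ↭ S s x →
            Linked (λ a b → δ s x a ℤ.≤ δ s x b) ord →
            Reachable (heal s x ord)

Adj' : ∀ {n} → State n → Fin n → Fin n → Set
Adj' s u v = (alive s u ≡ true) × (alive s v ≡ true) × (E' s u v ≡ true)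

IsCycle : ∀ {n} → (Fin n → Fin n → Set) → Fin n → List (Fin n) → Set
IsCycle R v vs = (2 ≤ length vs) × Unique (v ∷ vs) × Linked R (v ∷ vs ++ [ v ])

Forest : ∀ {n} → State n → Set
Forest {n} s = ∀ (v : Fin n) (vs : List (Fin n)) → ¬ IsCycle (Adj' s) v vs

module Submission where

-- Along every run, G' stays a forest on which IDs are constant along edges.  When x is deleted,
-- the nodes of S lie in pairwise different components of G' − x: members of UN(x,G) have pairwise
-- distinct IDs, all different from ID x, which every member of N(x,G') carries; and two members of
-- N(x,G') could only be joined through x, since G' was a forest.  A tree on such nodes keeps G' a
-- forest, and MINID is then written over the whole new component.  Neither the connectivity of G
-- nor the δ-order used to fill the tree plays any role.

open import Defs
open import Data.Nat using (ℕ; zero; _<ᵇ_; _≡ᵇ_; suc; _+_; s≤s; z≤n; _≤_; _<_; s≤s⁻¹; _≤?_; ⌊_/2⌋)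
open import Data.Nat.Properties using (m≤n⇒m≤1+n; <⇒≱; ≰⇒>; ≤-<-trans; <-≤-trans; +-comm; ⌊n/2⌋≤n; <-cmp; <⇒<ᵇ; ≡⇒≡ᵇ)
open import Data.Bool using (Bool; true; false; T; not; _∧_; _∨_)
open import Data.Bool.Properties using (T-≡; ∨-zeroʳ)
open import Data.Bool.ListAction using (any; all)
open import Data.Fin using (Fin; toℕ)
open import Data.Fin.Properties using (toℕ-injective)
open import Relation.Binary.Definitions using (tri<; tri≈; tri>)
open import Data.Maybe using (just; nothing)

open import Level using (0ℓ)
open import Data.Empty using (⊥-elim)
open import Data.List using (List; []; _∷_; _++_; [_]; filterᵇ; allFin; length)
open import Data.List.Properties using (length-filter; length-tabulate; length-++; ∷ʳ-++)
open import Data.List.Membership.Propositional using (_∈_; lose; find)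
open import Data.List.Membership.Propositional.Properties using (∈-filter⁻; ∈-++⁺ʳ; ∈-++⁻; ∈-allFin)
open import Data.List.Relation.Unary.Any.Properties using (any⁺; any⁻)
open import Data.List.Relation.Unary.All.Properties using (all⁺)
open import Data.List.Relation.Unary.Unique.Propositional using (Unique)
open import Data.List.Relation.Unary.Unique.Propositional.Properties using (++⁺; filter⁺; allFin⁺)
open import Data.List.Relation.Binary.Permutation.Propositional using (_↭_; ↭-sym; ↭⇒↭ₛ)
open import Data.List.Relation.Binary.Permutation.Propositional.Properties using (∈-resp-↭)
import Data.List.Relation.Binary.Permutation.Setoid.Properties as PermProperties
open import Data.List.Relation.Unary.All as All using (All; []; _∷_)
open import Data.List.Relation.Unary.AllPairs as AllPairs using (AllPairs; []; _∷_)
open import Data.List.Relation.Unary.Any as Any using (Any; here; there)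
open import Data.List.Relation.Unary.Linked using (Linked; [-]; _∷_)
open import Data.Product as Product using (_×_; _,_; proj₁; proj₂; ∃)
open import Data.Sum using (_⊎_; inj₁; inj₂; swap)
open import Function using (_∘_; id; case_of_)
open import Function.Bundles using (Equivalence)
open import Relation.Binary.Core using (Rel; _⇒_)
open import Relation.Binary.Definitions using (Symmetric)
open import Relation.Binary.Construct.Union using (_∪_)
import Relation.Binary.Construct.Union as Union
open import Relation.Binary.Construct.Closure.ReflexiveTransitive
  using (Star; ε; _◅_; _◅◅_; reverse; fold)
  renaming (map to starMap)
open import Relation.Binary.PropositionalEquality as ≡ using (_≡_; _≢_; refl; sym; trans; subst; cong; ≢-sym)
open import Relation.Nullary using (¬_; contradiction; yes; no)
open import Relation.Nullary.Decidable using (T?; toWitness; fromWitness; toWitnessFalse; fromWitnessFalse)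

T⇒≡ : ∀ {b} → T b → b ≡ true
T⇒≡ = Equivalence.to T-≡

≡⇒T : ∀ {b} → b ≡ true → T b
≡⇒T = Equivalence.from T-≡

∧-true⁻ : ∀ a {b} → a ∧ b ≡ true → a ≡ true × b ≡ true
∧-true⁻ true e = refl , e

∧-true⁺ : ∀ {a b} → a ≡ true → b ≡ true → a ∧ b ≡ true
∧-true⁺ refl e = e

∨-true⁻ : ∀ a {b} → a ∨ b ≡ true → a ≡ true ⊎ b ≡ true
∨-true⁻ true  _ = inj₁ refl
∨-true⁻ false e = inj₂ e

∨-trueˡ : ∀ {a} b → a ≡ true → a ∨ b ≡ true
∨-trueˡ _ refl = refl

∨-trueʳ : ∀ a {b} → b ≡ true → a ∨ b ≡ true
∨-trueʳ a refl = ∨-zeroʳ a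

true≢false : true ≢ false
true≢false ()

not-true⁻ : ∀ {b} → not b ≡ true → b ≡ false
not-true⁻ {false} _ = refl

not∨not-false : ∀ {a b} → a ≡ true → b ≡ true → not a ∨ not b ≢ true
not∨not-false refl refl ()

module _ {A : Set} where

  _—_ : A → A → Rel A 0ℓ
  (a — b) x y = (x ≡ a × y ≡ b) ⊎ (x ≡ b × y ≡ a)

  —-sym : ∀ {a b} → Symmetric (a — b)
  —-sym (inj₁ (x≡a , y≡b)) = inj₂ (y≡b , x≡a)
  —-sym (inj₂ (x≡b , y≡a)) = inj₁ (y≡a , x≡b)

  —-same : ∀ {a b u v x y} → (a — b) u v → (a — b) x y → (u — v) x y
  —-same (inj₁ (refl , refl)) e = e
  —-same (inj₂ (refl , refl)) e = swap e

  ¬—-from : ∀ {u w y z} → u ≢ y → w ≢ y → ¬ (u — w) y z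
  ¬—-from u≢y _ (inj₁ (y≡u , _)) = u≢y (sym y≡u)
  ¬—-from _ w≢y (inj₂ (y≡w , _)) = w≢y (sym y≡w)

  _∖_ : Rel A 0ℓ → Rel A 0ℓ → Rel A 0ℓ
  (R ∖ Q) x y = R x y × ¬ Q x y

  -- Every edge is a bridge: no path joins its ends once it is removed.
  Acyclic : Rel A 0ℓ → Set
  Acyclic R = ∀ {u v} → R u v → ¬ Star (R ∖ (u — v)) v u

  acyclic-⊆ : ∀ {Q R : Rel A 0ℓ} → Q ⇒ R → Acyclic R → Acyclic Q
  acyclic-⊆ Q⇒R acyc q path = acyc (Q⇒R q) (starMap (λ (q′ , ¬e) → Q⇒R q′ , ¬e) path)

  constant-along : ∀ {R : Rel A 0ℓ} {B : Set} (f : A → B) →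
                    (∀ {x y} → R x y → f x ≡ f y) → ∀ {x y} → Star R x y → f x ≡ f y
  constant-along f resp = fold _ (trans ∘ resp) refl

  star-∪-—⁻ : ∀ {R : Rel A 0ℓ} {a b x y} → Star (R ∪ (a — b)) x y →
              Star R x y ⊎ (Star R x a × Star R b y) ⊎ (Star R x b × Star R a y)
  star-∪-—⁻ ε = inj₁ ε
  star-∪-—⁻ (inj₁ r ◅ path) with star-∪-—⁻ path
  ... | inj₁ p               = inj₁ (r ◅ p)
  ... | inj₂ (inj₁ (p , q))  = inj₂ (inj₁ (r ◅ p , q))
  ... | inj₂ (inj₂ (p , q))  = inj₂ (inj₂ (r ◅ p , q))
  star-∪-—⁻ (inj₂ (inj₁ (refl , refl)) ◅ path) with star-∪-—⁻ path
  ... | inj₁ p               = inj₂ (inj₁ (ε , p))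
  ... | inj₂ (inj₁ (_ , q))  = inj₂ (inj₁ (ε , q))
  ... | inj₂ (inj₂ (_ , q))  = inj₁ q
  star-∪-—⁻ (inj₂ (inj₂ (refl , refl)) ◅ path) with star-∪-—⁻ path
  ... | inj₁ p               = inj₂ (inj₂ (ε , p))
  ... | inj₂ (inj₁ (_ , q))  = inj₁ q
  ... | inj₂ (inj₂ (_ , q))  = inj₂ (inj₂ (ε , q))

  acyclic-∪-— : ∀ {R : Rel A 0ℓ} {a b} → Symmetric R → Acyclic R → ¬ Star R a b →
                Acyclic (R ∪ (a — b))
  acyclic-∪-— {R} {a} {b} sym-R acyc ¬a↝b {u} {v} (inj₁ r) path
    with star-∪-—⁻ (starMap old path)
    where
      old : (R ∪ (a — b)) ∖ (u — v) ⇒ (R ∖ (u — v)) ∪ (a — b)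
      old (inj₁ r′ , ¬e) = inj₁ (r′ , ¬e)
      old (inj₂ e  , _)  = inj₂ e
  ... | inj₁ p = acyc r p
  ... | inj₂ (inj₁ (v↝a , b↝u)) =
    ¬a↝b (reverse sym-R (starMap proj₁ v↝a) ◅◅ sym-R r ◅ reverse sym-R (starMap proj₁ b↝u))
  ... | inj₂ (inj₂ (v↝b , a↝u)) = ¬a↝b (starMap proj₁ a↝u ◅◅ r ◅ starMap proj₁ v↝b)
  acyclic-∪-— {R} {a} {b} sym-R acyc ¬a↝b {u} {v} (inj₂ uv) path = ¬a↝b (ends uv (starMap old path))
    where
      old : (R ∪ (a — b)) ∖ (u — v) ⇒ R
      old (inj₁ r , _)  = r
      old (inj₂ e , ¬e) = ⊥-elim (¬e (—-same uv e))
      ends : (a — b) u v → Star R v u → Star R a b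
      ends (inj₁ (refl , refl)) p = reverse sym-R p
      ends (inj₂ (refl , refl)) p = p

  _∖ᵥ_ : Rel A 0ℓ → A → Rel A 0ℓ
  (R ∖ᵥ x) a b = R a b × a ≢ x × b ≢ x

  acyclic⇒irreflexive : ∀ {R : Rel A 0ℓ} {x} → Acyclic R → ¬ R x x
  acyclic⇒irreflexive acyc r = acyc r ε

  acyclic-neighbours : ∀ {R : Rel A 0ℓ} {x y z} → Symmetric R → Acyclic R →
                       R x y → R x z → y ≢ z → ¬ Star (R ∖ᵥ x) y z
  acyclic-neighbours {R} {x} {y} {z} sym-R acyc xy xz y≢z path =
    acyc xy (starMap avoid path ◅◅ (sym-R xz , ¬last) ◅ ε)
    where
      avoid : R ∖ᵥ x ⇒ R ∖ (x — y)
      avoid (r , a≢x , b≢x) = r , λ { (inj₁ (a≡x , _)) → a≢x a≡x ; (inj₂ (_ , b≡x)) → b≢x b≡x }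
      ¬last : ¬ (x — y) z x
      ¬last (inj₁ (refl , _)) = acyclic⇒irreflexive acyc xz
      ¬last (inj₂ (z≡y , _))  = y≢z (sym z≡y)

  Separated : Rel A 0ℓ → (A → Set) → A → Set
  Separated R V c = ∀ {z} → V z → c ≢ z → ¬ Star R c z

  separated-∪-— : ∀ {R : Rel A 0ℓ} {V a b c} → V a → V b → c ≢ a → c ≢ b →
                  Separated R V c → Separated (R ∪ (a — b)) V c
  separated-∪-— Va Vb c≢a c≢b sep Vz c≢z path with star-∪-—⁻ path
  ... | inj₁ c↝z             = sep Vz c≢z c↝z
  ... | inj₂ (inj₁ (c↝a , _)) = sep Va c≢a c↝a
  ... | inj₂ (inj₂ (c↝b , _)) = sep Vb c≢b c↝b

  Edges : List (A × A) → Rel A 0ℓ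
  Edges ps x y = Any (λ e → (proj₁ e — proj₂ e) x y) ps

  -- In AllPairs Fresh ps, the new vertex of every later pair avoids both ends of each earlier pair.
  Fresh : Rel (A × A) 0ℓ
  Fresh e f = proj₁ f ≢ proj₁ e × proj₁ f ≢ proj₂ e

  Attaching : List (A × A) → Set
  Attaching ps = All (λ e → proj₁ e ≢ proj₂ e) ps × AllPairs Fresh ps

  acyclic-∪-Edges : ∀ {R : Rel A 0ℓ} {V} {ps : List (A × A)} → Symmetric R → Acyclic R →
                    All (λ e → V (proj₁ e) × V (proj₂ e)) ps → All (Separated R V ∘ proj₁) ps →
                    Attaching ps → Acyclic (R ∪ Edges ps)
  acyclic-∪-Edges {ps = []} _ acyc [] [] _ = acyclic-⊆ (λ { (inj₁ r) → r ; (inj₂ ()) }) acyc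
  acyclic-∪-Edges {R} {V} {(a , p) ∷ ps} sym-R acyc ((Va , Vp) ∷ ends) (sep-a ∷ seps)
                  (a≢p ∷ distinct , fresh ∷ freshs) =
    acyclic-⊆ reassoc
      (acyclic-∪-Edges {R ∪ (a — p)} {V} {ps} sym′ (acyclic-∪-— sym-R acyc (sep-a Vp a≢p)) ends
        (All.zipWith (λ {f} → still-separated {f}) (seps , fresh)) (distinct , freshs))
    where
      sym′ : Symmetric (R ∪ (a — p))
      sym′ = Union.symmetric {L = R} {R = a — p} sym-R (—-sym {a} {p})
      reassoc : R ∪ Edges ((a , p) ∷ ps) ⇒ (R ∪ (a — p)) ∪ Edges ps
      reassoc (inj₁ r)         = inj₁ (inj₁ r)
      reassoc (inj₂ (here e))  = inj₁ (inj₂ e)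
      reassoc (inj₂ (there e)) = inj₂ e
      still-separated : ∀ {f : A × A} → Separated R V (proj₁ f) × Fresh (a , p) f →
                        Separated (R ∪ (a — p)) V (proj₁ f)
      still-separated (sep , c≢a , c≢p) = separated-∪-— Va Vp c≢a c≢p sep

  Edges-sym : ∀ {ps} → Symmetric (Edges ps)
  Edges-sym = Any.map —-sym

  Edges-ends : ∀ {V : A → Set} {ps u v} → (∀ {e} → e ∈ ps → V (proj₁ e) × V (proj₂ e)) →
               Edges ps u v → V u × V v
  Edges-ends ends uv with find uv
  ... | _ , e∈ , inj₁ (refl , refl) = ends e∈
  ... | _ , e∈ , inj₂ (refl , refl) = Product.swap (ends e∈)

  linked⇒star-∖ : ∀ {R : Rel A 0ℓ} {u w y z ys} → All (u ≢_) (y ∷ ys) → All (w ≢_) (y ∷ ys) →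
                  Linked R (y ∷ ys ++ [ z ]) → Star (R ∖ (u — w)) y z
  linked⇒star-∖ {ys = []} (u≢y ∷ _) (w≢y ∷ _) (r ∷ [-]) = (r , ¬—-from u≢y w≢y) ◅ ε
  linked⇒star-∖ {ys = _ ∷ _} (u≢y ∷ u∉) (w≢y ∷ w∉) (r ∷ path) =
    (r , ¬—-from u≢y w≢y) ◅ linked⇒star-∖ u∉ w∉ path

acyclic⇒¬IsCycle : ∀ {n} {R : Rel (Fin n) 0ℓ} → Acyclic R → ∀ v vs → ¬ IsCycle R v vs
acyclic⇒¬IsCycle acyc v []      (() , _)
acyclic⇒¬IsCycle acyc v (_ ∷ []) (s≤s () , _)
acyclic⇒¬IsCycle acyc v (v₁ ∷ v₂ ∷ vs) (_ , (v∉ ∷ v₁∉ ∷ _) , (vv₁ ∷ v₁v₂ ∷ path)) =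
  acyc vv₁ ((v₁v₂ , ¬first) ◅ linked⇒star-∖ (All.tail v∉) v₁∉ path)
  where
    ¬first : ¬ (v — v₁) v₁ v₂
    ¬first (inj₁ (v₁≡v , _)) = All.head v∉ (sym v₁≡v)
    ¬first (inj₂ (_ , v₂≡v)) = All.head (All.tail v∉) (sym v₂≡v)

module _ {A : Set} where

  unique-++-apart : ∀ (xs : List A) {ys x y} → Unique (xs ++ ys) → x ∈ xs → y ∈ ys → x ≢ y
  unique-++-apart (_ ∷ xs) (x∉ ∷ _) (here refl) y∈ys = All.lookup x∉ (∈-++⁺ʳ xs y∈ys)
  unique-++-apart (_ ∷ xs) (_ ∷ u)  (there x∈xs) y∈ys = unique-++-apart xs u x∈xs y∈ys

  unique-++⁻ʳ : ∀ (xs : List A) {ys} → Unique (xs ++ ys) → Unique ys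
  unique-++⁻ʳ []       u       = u
  unique-++⁻ʳ (_ ∷ xs) (_ ∷ u) = unique-++⁻ʳ xs u

  unique-resp-↭ : ∀ {xs ys : List A} → xs ↭ ys → Unique xs → Unique ys
  unique-resp-↭ xs↭ys = PermProperties.Unique-resp-↭ (≡.setoid A) (↭⇒↭ₛ xs↭ys)

  ∈-filterᵇ⁻ : ∀ (p : A → Bool) {xs y} → y ∈ filterᵇ p xs → y ∈ xs × p y ≡ true
  ∈-filterᵇ⁻ p y∈ = Product.map₂ T⇒≡ (∈-filter⁻ (T? ∘ p) y∈)

  any-true⁺ : ∀ (g : A → Bool) {xs x} → x ∈ xs → g x ≡ true → any g xs ≡ true
  any-true⁺ g x∈xs gx = T⇒≡ (any⁺ g (lose x∈xs (≡⇒T gx)))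

  any-true⁻ : ∀ (g : A → Bool) {xs} → any g xs ≡ true → ∃ λ x → x ∈ xs × g x ≡ true
  any-true⁻ g {xs} e = Product.map₂ (Product.map₂ T⇒≡) (find (any⁻ g xs (≡⇒T e)))

  all-true⁻ : ∀ (g : A → Bool) {xs x} → all g xs ≡ true → x ∈ xs → g x ≡ true
  all-true⁻ g {xs} e x∈xs = T⇒≡ (All.lookup (all⁺ g xs (≡⇒T e)) x∈xs)

  count-mono : ∀ (p q : A → Bool) xs → (∀ x → p x ≡ true → q x ≡ true) → count p xs ≤ count q xs
  count-mono p q []       p⇒q = z≤n
  count-mono p q (x ∷ xs) p⇒q with p x in px | q x in qx
  ... | true  | true  = s≤s (count-mono p q xs p⇒q)
  ... | true  | false = contradiction (trans (sym (p⇒q x px)) qx) true≢false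
  ... | false | true  = m≤n⇒m≤1+n (count-mono p q xs p⇒q)
  ... | false | false = count-mono p q xs p⇒q

  count-≤⇒reflects : ∀ (p q : A → Bool) xs → (∀ x → p x ≡ true → q x ≡ true) →
                     count q xs ≤ count p xs → ∀ {y} → y ∈ xs → q y ≡ true → p y ≡ true
  count-≤⇒reflects p q (x ∷ xs) p⇒q le y∈ qy with p x in px | q x in qx
  ... | true  | true  = case y∈ of λ
    { (here refl) → px ; (there y∈xs) → count-≤⇒reflects p q xs p⇒q (s≤s⁻¹ le) y∈xs qy }
  ... | true  | false = contradiction (trans (sym (p⇒q x px)) qx) true≢false
  ... | false | true  = contradiction (count-mono p q xs p⇒q) (<⇒≱ le)
  ... | false | false = case y∈ of λ
    { (here refl) → contradiction (trans (sym qy) qx) true≢false ; (there y∈xs) → count-≤⇒reflects p q xs p⇒q le y∈xs qy }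

module Chain {n : ℕ} (f : ℕ → Fin n → Bool) (grow : ∀ k {y} → f k y ≡ true → f (suc k) y ≡ true) where

  Stable : ℕ → Set
  Stable k = ∀ {y} → f (suc k) y ≡ true → f k y ≡ true

  stable-if-not-grown : ∀ k → count (f (suc k)) (allFin n) ≤ count (f k) (allFin n) → Stable k
  stable-if-not-grown k le = count-≤⇒reflects (f k) (f (suc k)) (allFin n) (λ _ → grow k) le (∈-allFin _)

  stable-or-grown : (∀ {k} → Stable k → Stable (suc k)) → ∀ k → Stable k ⊎ k < count (f (suc k)) (allFin n)
  stable-or-grown _ zero with count (f 1) (allFin n) ≤? count (f 0) (allFin n)
  ... | yes le = inj₁ (stable-if-not-grown 0 le)
  ... | no  gt = inj₂ (≤-<-trans z≤n (≰⇒> gt))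
  stable-or-grown stable-suc (suc k)
    with stable-or-grown stable-suc k | count (f (suc (suc k))) (allFin n) ≤? count (f (suc k)) (allFin n)
  ... | inj₁ st | _      = inj₁ (stable-suc st)
  ... | inj₂ _  | yes le = inj₁ (stable-if-not-grown (suc k) le)
  ... | inj₂ lt | no gt  = inj₂ (<-≤-trans (s≤s lt) (≰⇒> gt))

  -- A growing chain of subsets of Fin n cannot strictly grow n + 1 times in a row.
  stable-at-n : (∀ {k} → Stable k → Stable (suc k)) → Stable n
  stable-at-n stable-suc with stable-or-grown stable-suc n
  ... | inj₁ st  = st
  ... | inj₂ big = contradiction (subst (count (f (suc n)) (allFin n) ≤_) (length-tabulate id)
                                        (length-filter (T? ∘ f (suc n)) (allFin n)))
                                 (<⇒≱ big)

==-refl : ∀ {n} (u : Fin n) → (u == u) ≡ true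
==-refl u = T⇒≡ (fromWitness refl)

module _ {n : ℕ} {u v : Fin n} where

  ==⇒≡ : (u == v) ≡ true → u ≡ v
  ==⇒≡ e = toWitness (≡⇒T e)

  not-==⇒≢ : not (u == v) ≡ true → u ≢ v
  not-==⇒≢ e = toWitnessFalse (≡⇒T e)

  ≢⇒not-== : u ≢ v → not (u == v) ≡ true
  ≢⇒not-== u≢v = T⇒≡ (fromWitnessFalse u≢v)

module TreeEdges {n : ℕ} (G : SimpleGraph n) (id0 : Fin n → ℕ) where
  open DASH G id0

  nth-∈ : ∀ xs k {q} → nth xs k ≡ just q → q ∈ xs
  nth-∈ (x ∷ xs) zero    refl = here refl
  nth-∈ (x ∷ xs) (suc k) e    = there (nth-∈ xs k e)

  nth-∈-prefix : ∀ pre {rest} k {q} → nth (pre ++ rest) k ≡ just q → k < length pre → q ∈ pre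
  nth-∈-prefix (x ∷ pre) zero    refl _         = here refl
  nth-∈-prefix (x ∷ pre) (suc k) e    (s≤s k<) = there (nth-∈-prefix pre k e k<)

  pairsFrom-∈ : ∀ i full rest {e} → e ∈ pairsFrom i full rest → proj₁ e ∈ rest × proj₂ e ∈ full
  pairsFrom-∈ zero    full (a ∷ as) e∈ = Product.map₁ there (pairsFrom-∈ 1 full as e∈)
  pairsFrom-∈ (suc j) full (a ∷ as) e∈ with nth full ⌊ j /2⌋ in eq
  ... | nothing = Product.map₁ there (pairsFrom-∈ (suc (suc j)) full as e∈)
  ... | just p with e∈
  ...   | here refl = here refl , nth-∈ full ⌊ j /2⌋ eq
  ...   | there e∈′ = Product.map₁ there (pairsFrom-∈ (suc (suc j)) full as e∈′)

  private
    shift : ∀ {pre : List (Fin n)} {a as full i} → pre ++ a ∷ as ≡ full → length pre ≡ i →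
            (pre ++ [ a ]) ++ as ≡ full × length (pre ++ [ a ]) ≡ suc i
    shift {pre} {a} {as} {i = i} eq len =
      trans (∷ʳ-++ pre a as) eq , trans (length-++ pre) (trans (cong (_+ 1) len) (+-comm i 1))

  -- pre is the part of full already placed in the tree, rest the part still to be attached.
  pairsFrom-fresh : ∀ full i pre rest → Unique full → pre ++ rest ≡ full → length pre ≡ i →
                    Attaching (pairsFrom i full rest)
  pairsFrom-fresh full i pre [] _ _ _ = [] , []
  pairsFrom-fresh full zero pre (a ∷ as) u eq len =
    let eq′ , len′ = shift eq len in pairsFrom-fresh full 1 (pre ++ [ a ]) as u eq′ len′
  pairsFrom-fresh full (suc j) pre (a ∷ as) u eq len with nth full ⌊ j /2⌋ in nth≡
  ... | nothing = let eq′ , len′ = shift eq len in pairsFrom-fresh full (suc (suc j)) (pre ++ [ a ]) as u eq′ len′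
  ... | just p  = (a≢p ∷ proj₁ attaching) , (All.tabulate later ∷ proj₂ attaching)
    where
      u′ : Unique (pre ++ a ∷ as)
      u′ = subst Unique (sym eq) u
      p∈pre : p ∈ pre
      p∈pre = nth-∈-prefix pre ⌊ j /2⌋ (subst (λ l → nth l ⌊ j /2⌋ ≡ just p) (sym eq) nth≡)
                (subst (⌊ j /2⌋ <_) (sym len) (s≤s (⌊n/2⌋≤n j)))
      a≢p : a ≢ p
      a≢p = ≢-sym (unique-++-apart pre u′ p∈pre (here refl))
      later : ∀ {f} → f ∈ pairsFrom (suc (suc j)) full as → Fresh (a , p) f
      later f∈ = let c∈as = proj₁ (pairsFrom-∈ (suc (suc j)) full as f∈) in
        ≢-sym (All.lookup (AllPairs.head (unique-++⁻ʳ pre u′)) c∈as) ,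
        ≢-sym (unique-++-apart pre u′ p∈pre (there c∈as))
      attaching : Attaching (pairsFrom (suc (suc j)) full as)
      attaching = let eq′ , len′ = shift eq len in pairsFrom-fresh full (suc (suc j)) (pre ++ [ a ]) as u eq′ len′

  —⇒== : ∀ {a b u v : Fin n} → (a — b) u v → ((a == u) ∧ (b == v)) ∨ ((a == v) ∧ (b == u)) ≡ true
  —⇒== {a} {b} (inj₁ (refl , refl)) = ∨-trueˡ ((a == b) ∧ (b == a)) (∧-true⁺ (==-refl a) (==-refl b))
  —⇒== {a} {b} (inj₂ (refl , refl)) = ∨-trueʳ ((a == b) ∧ (b == a)) (∧-true⁺ (==-refl a) (==-refl b))

  ==⇒— : ∀ {a b u v : Fin n} → ((a == u) ∧ (b == v)) ∨ ((a == v) ∧ (b == u)) ≡ true → (a — b) u v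
  ==⇒— {a} {b} {u} {v} e with ∨-true⁻ ((a == u) ∧ (b == v)) e
  ... | inj₁ e₁ = let a≡u , b≡v = ∧-true⁻ (a == u) e₁ in inj₁ (sym (==⇒≡ a≡u) , sym (==⇒≡ b≡v))
  ... | inj₂ e₂ = let a≡v , b≡u = ∧-true⁻ (a == v) e₂ in inj₂ (sym (==⇒≡ b≡u) , sym (==⇒≡ a≡v))

  treeEdge⇒Edges : ∀ {l u v} → treeEdge l u v ≡ true → Edges (treePairs l) u v
  treeEdge⇒Edges e = let _ , e∈ , edge = any-true⁻ _ e in lose e∈ (==⇒— edge)

  Edges⇒treeEdge : ∀ {l u v} → Edges (treePairs l) u v → treeEdge l u v ≡ true
  Edges⇒treeEdge es = let _ , e∈ , edge = find es in any-true⁺ _ e∈ (—⇒== edge)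

module Healing {n : ℕ} (G : SimpleGraph n) (id0 : Fin n → ℕ) where
  open DASH G id0
  open TreeEdges G id0

  record Invariant (s : State n) : Set where
    field
      symmetric : Symmetric (Adj' s)
      acyclic   : Acyclic (Adj' s)
      ID-const  : ∀ {u v} → Adj' s u v → ID s u ≡ ID s v

  precedes-connex : ∀ {y z} → y ≢ z → precedes y z ≡ true ⊎ precedes z y ≡ true
  precedes-connex {y} {z} y≢z with <-cmp (id0 y) (id0 z)
  ... | tri< lt _ _ = inj₁ (∨-trueˡ _ (T⇒≡ (<⇒<ᵇ lt)))
  ... | tri> _ _ gt = inj₂ (∨-trueˡ _ (T⇒≡ (<⇒<ᵇ gt)))
  ... | tri≈ _ eq _ with <-cmp (toℕ y) (toℕ z)
  ...   | tri< lt _ _ = inj₁ (∨-trueʳ (id0 y <ᵇ id0 z) (∧-true⁺ (T⇒≡ (≡⇒≡ᵇ _ _ eq)) (T⇒≡ (<⇒<ᵇ lt))))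
  ...   | tri> _ _ gt = inj₂ (∨-trueʳ (id0 z <ᵇ id0 y) (∧-true⁺ (T⇒≡ (≡⇒≡ᵇ _ _ (sym eq))) (T⇒≡ (<⇒<ᵇ gt))))
  ...   | tri≈ _ eq′ _ = contradiction (toℕ-injective eq′) y≢z

  module Reach (H : Graph n) (R : Fin n → Bool) where

    reach-grow : ∀ k {y} → reachWithin k H R y ≡ true → reachWithin (suc k) H R y ≡ true
    reach-grow k {y} = ∨-trueˡ (any (λ z → reachWithin k H R z ∧ H z y) (allFin n))

    reach-step : ∀ k {u v} → reachWithin k H R u ≡ true → H u v ≡ true → reachWithin (suc k) H R v ≡ true
    reach-step k {u} {v} ru huv =
      ∨-trueʳ (reachWithin k H R v) (any-true⁺ (λ z → reachWithin k H R z ∧ H z v) (∈-allFin u) (∧-true⁺ ru huv))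

    reach-base : ∀ k {y} → R y ≡ true → reachWithin k H R y ≡ true
    reach-base zero    Ry = Ry
    reach-base (suc k) Ry = reach-grow k (reach-base k Ry)

    reach-closed : ∀ {u v} → reachWithin n H R u ≡ true → H u v ≡ true → reachWithin n H R v ≡ true
    reach-closed ru huv = stable-at-n (λ {k} → stable-suc {k}) (reach-step n ru huv)
      where
        open Chain (λ k → reachWithin k H R) reach-grow using (Stable; stable-at-n)
        stable-suc : ∀ {k} → Stable k → Stable (suc k)
        stable-suc {k} stable {y} ry with ∨-true⁻ (reachWithin (suc k) H R y) ry
        ... | inj₁ ry′ = ry′
        ... | inj₂ via = let z , _ , rzy = any-true⁻ (λ z → reachWithin (suc k) H R z ∧ H z y) {allFin n} via
                             rz , hzy = ∧-true⁻ (reachWithin (suc k) H R z) rzy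
                         in reach-step k (stable rz) hzy

  module Round (s : State n) (x : Fin n) where

    Adj'-delete⁻ : Adj' (delete s x) ⇒ Adj' s ∖ᵥ x
    Adj'-delete⁻ {a} {b} (a-alive , b-alive , ab) =
      let a-alive′ , a≢x = ∧-true⁻ (alive s a) a-alive
          b-alive′ , b≢x = ∧-true⁻ (alive s b) b-alive
      in (a-alive′ , b-alive′ , proj₁ (∧-true⁻ (E' s a b) ab)) , not-==⇒≢ a≢x , not-==⇒≢ b≢x

    Adj'-delete⁺ : Adj' s ∖ᵥ x ⇒ Adj' (delete s x)
    Adj'-delete⁺ ((a-alive , b-alive , ab) , a≢x , b≢x) =
      ∧-true⁺ a-alive (≢⇒not-== a≢x) , ∧-true⁺ b-alive (≢⇒not-== b≢x) ,
      ∧-true⁺ ab (∧-true⁺ (≢⇒not-== a≢x) (≢⇒not-== b≢x))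

    ∈-NG⁻ : ∀ {y} → y ∈ NG s x → alive s y ≡ true × y ≢ x
    ∈-NG⁻ {y} y∈ =
      let _ , e = ∈-filterᵇ⁻ (λ y → alive s y ∧ E s x y ∧ not (y == x)) {allFin n} y∈
          y-alive , e′ = ∧-true⁻ (alive s y) e
      in y-alive , not-==⇒≢ (proj₂ (∧-true⁻ (E s x y) e′))

    ∈-NG'⁻ : ∀ {y} → alive s x ≡ true → y ∈ NG' s x → Adj' s x y × y ≢ x
    ∈-NG'⁻ {y} x-alive y∈ =
      let _ , e = ∈-filterᵇ⁻ (λ y → alive s y ∧ E' s x y ∧ not (y == x)) {allFin n} y∈
          y-alive , e′ = ∧-true⁻ (alive s y) e
          xy , y≢x = ∧-true⁻ (E' s x y) e′
      in (x-alive , y-alive , xy) , not-==⇒≢ y≢x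

    ∈-cand⁻ : ∀ {y} → y ∈ cand s x → y ∈ NG s x × ID s y ≢ ID s x
    ∈-cand⁻ y∈ =
      let y∈NG , e = ∈-filterᵇ⁻ (λ y → not (ID s y ≡ᵇ ID s x)) {NG s x} y∈
      in y∈NG , λ eq → contradiction (trans (sym (T⇒≡ (≡⇒≡ᵇ _ _ eq))) (not-true⁻ e)) true≢false

    ∈-UN⁻ : ∀ {y} → y ∈ UN s x →
            y ∈ cand s x × all (λ z → not (ID s z ≡ᵇ ID s y) ∨ not (precedes z y)) (cand s x) ≡ true
    ∈-UN⁻ {y} = ∈-filterᵇ⁻ (λ y → all (λ z → not (ID s z ≡ᵇ ID s y) ∨ not (precedes z y)) (cand s x)) {cand s x}

    ∈-S⁻ : ∀ {y} → y ∈ S s x → y ∈ UN s x ⊎ y ∈ NG' s x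
    ∈-S⁻ y∈ with ∈-++⁻ (UN s x) y∈
    ... | inj₁ y∈UN   = inj₁ y∈UN
    ... | inj₂ y∈rest = inj₂ (proj₁ (∈-filterᵇ⁻ (λ y → not (elem y (UN s x))) {NG' s x} y∈rest))

    -- UN keeps only the precedes-least member of each ID class.
    UN-IDs-distinct : ∀ {y z} → y ∈ UN s x → z ∈ UN s x → y ≢ z → ID s y ≢ ID s z
    UN-IDs-distinct {y} {z} y∈ z∈ y≢z eq with precedes-connex y≢z
    ... | inj₁ y<z = not∨not-false (T⇒≡ (≡⇒≡ᵇ _ _ eq)) y<z
                       (all-true⁻ _ (proj₂ (∈-UN⁻ z∈)) (proj₁ (∈-UN⁻ y∈)))
    ... | inj₂ z<y = not∨not-false (T⇒≡ (≡⇒≡ᵇ _ _ (sym eq))) z<y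
                       (all-true⁻ _ (proj₂ (∈-UN⁻ y∈)) (proj₁ (∈-UN⁻ z∈)))

    unique-S : Unique (S s x)
    unique-S = ++⁺ unique-UN (filter⁺ (T? ∘ not ∘ (λ y → elem y (UN s x))) unique-NG') disjoint
      where
        unique-filter : ∀ (p : Fin n → Bool) {xs} → Unique xs → Unique (filterᵇ p xs)
        unique-filter p = filter⁺ (T? ∘ p)
        unique-UN : Unique (UN s x)
        unique-UN = unique-filter _ (unique-filter _ (unique-filter _ (allFin⁺ n)))
        unique-NG' : Unique (NG' s x)
        unique-NG' = unique-filter _ (allFin⁺ n)
        disjoint : ∀ {v} → ¬ (v ∈ UN s x × v ∈ filterᵇ (λ y → not (elem y (UN s x))) (NG' s x))
        disjoint {v} (v∈UN , v∈rest) =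
          contradiction (trans (sym (any-true⁺ (_== v) v∈UN (==-refl v)))
                               (not-true⁻ (proj₂ (∈-filterᵇ⁻ (λ y → not (elem y (UN s x))) {NG' s x} v∈rest))))
                        true≢false

    S-alive : ∀ {y} → alive s x ≡ true → y ∈ S s x → alive (delete s x) y ≡ true
    S-alive x-alive y∈ with ∈-S⁻ y∈
    ... | inj₁ y∈UN  = let y-alive , y≢x = ∈-NG⁻ (proj₁ (∈-cand⁻ (proj₁ (∈-UN⁻ y∈UN)))) in
                       ∧-true⁺ y-alive (≢⇒not-== y≢x)
    ... | inj₂ y∈NG' = let (_ , y-alive , _) , y≢x = ∈-NG'⁻ x-alive y∈NG' in
                       ∧-true⁺ y-alive (≢⇒not-== y≢x)

  module Step {s : State n} (inv : Invariant s) {x : Fin n} (x-alive : alive s x ≡ true)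
              {ord : List (Fin n)} (ord↭S : ord ↭ S s x) where
    open Invariant inv
    open Round s x

    R₁ : Rel (Fin n) 0ℓ
    R₁ = Adj' (delete s x)

    symmetric₁ : Symmetric R₁
    symmetric₁ r = let r′ , a≢x , b≢x = Adj'-delete⁻ r in Adj'-delete⁺ (symmetric r′ , b≢x , a≢x)

    acyclic₁ : Acyclic R₁
    acyclic₁ = acyclic-⊆ (proj₁ ∘ Adj'-delete⁻) acyclic

    ID-along : ∀ {a b} → Star R₁ a b → ID s a ≡ ID s b
    ID-along = constant-along (ID s) (ID-const ∘ proj₁ ∘ Adj'-delete⁻)

    S-separated : ∀ {y} → y ∈ S s x → Separated R₁ (_∈ S s x) y
    S-separated y∈ z∈ y≢z path with ∈-S⁻ y∈ | ∈-S⁻ z∈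
    ... | inj₁ y∈UN  | inj₁ z∈UN  = UN-IDs-distinct y∈UN z∈UN y≢z (ID-along path)
    ... | inj₁ y∈UN  | inj₂ z∈NG' = proj₂ (∈-cand⁻ (proj₁ (∈-UN⁻ y∈UN)))
                                      (trans (ID-along path) (sym (ID-const (proj₁ (∈-NG'⁻ x-alive z∈NG')))))
    ... | inj₂ y∈NG' | inj₁ z∈UN  = proj₂ (∈-cand⁻ (proj₁ (∈-UN⁻ z∈UN)))
                                      (trans (sym (ID-along path)) (sym (ID-const (proj₁ (∈-NG'⁻ x-alive y∈NG')))))
    ... | inj₂ y∈NG' | inj₂ z∈NG' = acyclic-neighbours symmetric acyclic
                                      (proj₁ (∈-NG'⁻ x-alive y∈NG')) (proj₁ (∈-NG'⁻ x-alive z∈NG')) y≢z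
                                      (starMap Adj'-delete⁻ path)

    ord⊆S : ∀ {y} → y ∈ ord → y ∈ S s x
    ord⊆S = ∈-resp-↭ ord↭S

    tree-ends : ∀ {e} → e ∈ treePairs ord → proj₁ e ∈ ord × proj₂ e ∈ ord
    tree-ends = pairsFrom-∈ 0 ord ord

    healed-acyclic : Acyclic (R₁ ∪ Edges (treePairs ord))
    healed-acyclic =
      acyclic-∪-Edges symmetric₁ acyclic₁ (All.tabulate tree-ends) (All.tabulate separated)
        (pairsFrom-fresh ord 0 [] ord (unique-resp-↭ (↭-sym ord↭S) unique-S) refl refl)
      where
        separated : ∀ {e} → e ∈ treePairs ord → Separated R₁ (_∈ ord) (proj₁ e)
        separated e∈ z∈ = S-separated (ord⊆S (proj₁ (tree-ends e∈))) (ord⊆S z∈)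

    Adj'-heal⁻ : Adj' (heal s x ord) ⇒ R₁ ∪ Edges (treePairs ord)
    Adj'-heal⁻ {u} {v} (u-alive , v-alive , uv) with ∨-true⁻ (E' (delete s x) u v) uv
    ... | inj₁ old = inj₁ (u-alive , v-alive , old)
    ... | inj₂ new = inj₂ (treeEdge⇒Edges {ord} new)

    Adj'-heal⁺ : R₁ ∪ Edges (treePairs ord) ⇒ Adj' (heal s x ord)
    Adj'-heal⁺ {u} {v} (inj₁ (u-alive , v-alive , old)) = u-alive , v-alive , ∨-trueˡ (treeEdge ord u v) old
    Adj'-heal⁺ {u} {v} (inj₂ new) =
      let u∈ , v∈ = Edges-ends tree-ends new in
      S-alive x-alive (ord⊆S u∈) , S-alive x-alive (ord⊆S v∈) ,
      ∨-trueʳ (E' (delete s x) u v) (Edges⇒treeEdge {ord} new)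

    symmetric-heal : Symmetric (Adj' (heal s x ord))
    symmetric-heal uv =
      Adj'-heal⁺ (Union.symmetric {L = R₁} {R = Edges (treePairs ord)} symmetric₁ Edges-sym (Adj'-heal⁻ uv))

    E'-heal : Graph n
    E'-heal u v = E' (delete s x) u v ∨ treeEdge ord u v

    open Reach E'-heal (λ y → elem y (S s x))

    -- The local inTree of DASH.heal, to which ID (heal s x ord) unfolds.
    in-tree : Fin n → Bool
    in-tree = reachWithin n E'-heal (λ y → elem y (S s x))

    -- Every healing edge lies inside the tree that receives MINID; every other edge keeps both old IDs.
    ID-const-heal : ∀ {u v} → Adj' (heal s x ord) u v → ID (heal s x ord) u ≡ ID (heal s x ord) v
    ID-const-heal {u} {v} uv with in-tree u in tu | in-tree v in tv
    ... | true  | true  = refl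
    ... | true  | false = contradiction (trans (sym (reach-closed tu (proj₂ (proj₂ uv)))) tv) true≢false
    ... | false | true  = contradiction (trans (sym (reach-closed tv (proj₂ (proj₂ (symmetric-heal uv))))) tu) true≢false
    ... | false | false with Adj'-heal⁻ uv
    ...   | inj₁ old = ID-const (proj₁ (Adj'-delete⁻ old))
    ...   | inj₂ new = contradiction (trans (sym (reach-base n (in-S (proj₁ (Edges-ends tree-ends new))))) tu) true≢false
      where
        in-S : ∀ {y} → y ∈ ord → elem y (S s x) ≡ true
        in-S {y} y∈ = any-true⁺ (_== y) (ord⊆S y∈) (==-refl y)

    invariant-heal : Invariant (heal s x ord)
    invariant-heal = record
      { symmetric = symmetric-heal
      ; acyclic   = acyclic-⊆ Adj'-heal⁻ healed-acyclic
      ; ID-const  = ID-const-heal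
      }

  invariant : ∀ {s} → Reachable s → Invariant s
  invariant start = record { symmetric = λ () ; acyclic = λ () ; ID-const = λ () }
  invariant (round reach x x-alive ord ord↭S _) = Step.invariant-heal (invariant reach) x-alive ord↭S

lemma1 : ∀ {n} (G : SimpleGraph n) → Connected G → (id0 : Fin n → ℕ) →
         ∀ {s} → DASH.Reachable G id0 s → Forest s
lemma1 G _ id0 reach = acyclic⇒¬IsCycle (Invariant.acyclic (invariant reach))
  where open Healing G id0
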